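{- Let $\ell \geq 2$ and let $\mathcal G \subset \binom{[2\ell]}{\ell}$ be non-trivial. For $r \geq 1$ let $t_r$ be the number of sets $T \in \binom{[2\ell]}{r}$ such that $T \cap G \neq \emptyset$ for all $G \in \mathcal G$. Then for every integer $r$ with $2 \leq r < \ell$, $$t_r \leq \binom{2\ell}{r} - 2\binom{\ell}{r}.$$
   Context: $[2\ell] = \{1,\dots,2\ell\}$ and $\binom{[2\ell]}{r}$ is the collection of its $r$-element subsets. A family $\mathcal G$ is non-trivial if $\bigcap_{G \in \mathcal G} G = \emptyset$. -}

module Defs where

open import Data.Nat using (ℕ; zero; suc)
open import Data.Bool using (true; false)
open import Data.Vec using (_∷_; [])
open import Data.List using (List; []; _∷_; map; _++_; filter; length)
open import Data.List.Relation.Unary.All using (All; all?)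
open import Data.Fin.Subset using (Subset; _∩_; Nonempty; ∣_∣; _∈_)
open import Data.Fin.Subset.Properties using (nonempty?)
open import Data.Fin using (Fin)
open import Data.Nat.Properties using (_≟_)
open import Relation.Nullary using (¬_)
open import Relation.Nullary.Decidable using (_×-dec_)
open import Data.Product using (_×_)
open import Relation.Binary.PropositionalEquality using (_≡_)

allSubsets : (n : ℕ) → List (Subset n)
allSubsets zero = [] ∷ []
allSubsets (suc n) = map (false ∷_) (allSubsets n) ++ map (true ∷_) (allSubsets n)

Transversal : {n : ℕ} → List (Subset n) → Subset n → Set
Transversal 𝒢 T = All (λ G → Nonempty (T ∩ G)) 𝒢

t : {n : ℕ} → List (Subset n) → ℕ → ℕ
t {n} 𝒢 r = length (filter (λ T → (∣ T ∣ ≟ r) ×-dec all? (λ G → nonempty? (T ∩ G)) 𝒢) (allSubsets n))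

Uniform : {n : ℕ} → ℕ → List (Subset n) → Set
Uniform k 𝒢 = All (λ G → ∣ G ∣ ≡ k) 𝒢

NonTrivial : {n : ℕ} → List (Subset n) → Set
NonTrivial {n} 𝒢 = (x : Fin n) → ¬ All (x ∈_) 𝒢

{-# OPTIONS --safe #-}
-- The r-sets split into the t_r transversals and the non-transversals, which miss some member
-- of 𝒢. For G ∈ 𝒢 the C(ℓ, r) r-sets inside ∁ G are non-transversals, so it suffices to find
-- C(ℓ, r) non-transversal r-sets meeting G. In fact at least C(∣Z∣, r) of them meet any Z with
-- ∣Z∣ ≤ ℓ, by induction on ∣Z∣: non-triviality gives a member G′ missing a point of Z, so Z ∩ G′
-- is smaller. The non-transversal r-sets meeting Z include those meeting Z ∩ G′ and, disjointly,
-- the r-sets inside ∁ G′ meeting Z; the latter are counted exactly, and convexity of j ↦ C(j, r)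
-- shows that there are at least C(∣Z∣, r) − C(∣Z ∩ G′∣, r) of them.
module Submission where

open import Defs
open import Level using (0ℓ)
open import Data.Nat using (ℕ; zero; suc; _+_; _*_; _∸_; _≤_; _<_; _≟_; z≤n; s≤s)
open import Data.Nat.Properties
  using (≤-refl; ≤-trans; ≤-reflexive; +-suc; +-comm; +-assoc; +-identityʳ; m+n∸m≡n; m≤n⇒m≤1+n;
         +-mono-≤; +-monoʳ-≤; +-cancelˡ-≤; +-cancelʳ-≤; module ≤-Reasoning)
open import Data.Nat.Induction using (<-wellFounded)
open import Data.Nat.Combinatorics using (_C_; nCk+nC[k+1]≡[n+1]C[k+1]; k>n⇒nCk≡0)
open import Data.Bool using (Bool; false; _∧_; _∨_; T)
open import Data.Vec using ([]; _∷_; here; there)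
open import Data.List using (List; []; _∷_; _++_; map; filter; length)
open import Data.List.Properties using (filter-++; length-++; filter-≐)
open import Data.List.Relation.Unary.All as All using (All; all?; lookup)
open import Data.List.Relation.Unary.All.Properties using (¬All⇒Any¬)
open import Data.List.Membership.Propositional using (find) renaming (_∈_ to _∈ₗ_)
open import Data.Fin using (zero; suc)
open import Data.Fin.Subset using (Subset; _∩_; _∪_; ∁; ∣_∣; Nonempty; _∉_; _⊆_; ⊥; inside; outside)
open import Data.Fin.Subset.Properties
  using (x∈p∩q⁻; x∈p∩q⁺; x∈p∪q⁻; p⊆p∪q; q⊆p∪q; p∩q⊆p; p∩q⊆q; ∉⊥; ∣p∩q∣≤∣p∣; p⊂q⇒∣p∣<∣q∣;
         ∣⊥∣≡0; ∣∁p∣≡n∸∣p∣; nonempty?; _∈?_; Empty-unique)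
open import Data.Product using (_×_; _,_; proj₁; proj₂; map₁; map₂; ∃-syntax)
open import Data.Sum using (inj₁; inj₂)
open import Data.Empty using (⊥-elim)
open import Function using (_∘_)
open import Induction.WellFounded using (Acc; acc)
open import Relation.Nullary using (¬_; Dec; yes; no; does; ¬?)
open import Relation.Nullary.Decidable using (_×-dec_; map′; T?)
open import Relation.Unary using (Pred; Decidable; _≐_)
open import Relation.Binary.PropositionalEquality

pascal : ∀ n k → suc n C suc k ≡ n C k + n C suc k
pascal n k = sym (nCk+nC[k+1]≡[n+1]C[k+1] n k)

C-monoˡ-≤ : ∀ k {m n} → m ≤ n → m C k ≤ n C k
C-monoˡ-≤ zero    _                     = ≤-refl
C-monoˡ-≤ (suc k) z≤n                   = z≤n
C-monoˡ-≤ (suc k) (s≤s {m} {n} m≤n) rewrite pascal m k | pascal n k =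
  +-mono-≤ (C-monoˡ-≤ k m≤n) (C-monoˡ-≤ (suc k) m≤n)

C-convex : ∀ k e {a b} → a ≤ b → (e + a) C k + b C k ≤ (e + b) C k + a C k
C-convex k       zero    {a} {b} _ = ≤-reflexive (+-comm (a C k) (b C k))
C-convex zero    (suc e) _         = ≤-refl
C-convex (suc k) (suc e) {a} {b} a≤b = begin
  suc (e + a) C suc k + b C suc k
    ≡⟨ cong (_+ b C suc k) (pascal (e + a) k) ⟩
  (e + a) C k + (e + a) C suc k + b C suc k
    ≡⟨ +-assoc ((e + a) C k) _ _ ⟩
  (e + a) C k + ((e + a) C suc k + b C suc k)
    ≤⟨ +-mono-≤ (C-monoˡ-≤ k (+-monoʳ-≤ e a≤b)) (C-convex (suc k) e a≤b) ⟩
  (e + b) C k + ((e + b) C suc k + a C suc k)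
    ≡⟨ +-assoc ((e + b) C k) _ _ ⟨
  (e + b) C k + (e + b) C suc k + a C suc k
    ≡⟨ cong (_+ a C suc k) (pascal (e + b) k) ⟨
  suc (e + b) C suc k + a C suc k ∎
  where open ≤-Reasoning

count : {A : Set} {P : Pred A 0ℓ} → Decidable P → List A → ℕ
count P? xs = length (filter P? xs)

module _ {A : Set} {P : Pred A 0ℓ} (P? : Decidable P) where

  count-++ : ∀ xs ys → count P? (xs ++ ys) ≡ count P? xs + count P? ys
  count-++ xs ys = trans (cong length (filter-++ P? xs ys)) (length-++ (filter P? xs))

  count-map : {B : Set} (f : B → A) (xs : List B) → count P? (map f xs) ≡ count (λ x → P? (f x)) xs
  count-map f []       = refl
  count-map f (x ∷ xs) with P? (f x)
  ... | yes _ = cong suc (count-map f xs)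
  ... | no  _ = count-map f xs

  count-none : (∀ x → ¬ P x) → ∀ xs → count P? xs ≡ 0
  count-none ¬P []       = refl
  count-none ¬P (x ∷ xs) with P? x
  ... | yes px = ⊥-elim (¬P x px)
  ... | no  _  = count-none ¬P xs

  count-split : {Q : Pred A 0ℓ} (Q? : Decidable Q) → ∀ xs →
                count P? xs ≡ count (λ x → P? x ×-dec Q? x) xs + count (λ x → P? x ×-dec ¬? (Q? x)) xs
  count-split Q? []       = refl
  count-split Q? (x ∷ xs) with P? x | Q? x
  ... | yes _ | yes _ = cong suc (count-split Q? xs)
  ... | yes _ | no  _ = trans (cong suc (count-split Q? xs)) (sym (+-suc _ _))
  ... | no  _ | _     = count-split Q? xs

  module _ {Q : Pred A 0ℓ} (Q? : Decidable Q) where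

    count-cong : P ≐ Q → ∀ xs → count P? xs ≡ count Q? xs
    count-cong P≐Q xs = cong length (filter-≐ P? Q? P≐Q xs)

    count-does : (∀ x → does (P? x) ≡ does (Q? x)) → ∀ xs → count P? xs ≡ count Q? xs
    count-does eq []       = refl
    count-does eq (x ∷ xs) with P? x | Q? x | eq x
    ... | yes _ | yes _ | _ = cong suc (count-does eq xs)
    ... | no  _ | no  _ | _ = count-does eq xs
    ... | yes _ | no  _ | ()
    ... | no  _ | yes _ | ()

    count-+-≤ : {R : Pred A 0ℓ} (R? : Decidable R) →
                (∀ {x} → P x → R x) → (∀ {x} → Q x → R x) → (∀ {x} → P x → ¬ Q x) →
                ∀ xs → count P? xs + count Q? xs ≤ count R? xs
    count-+-≤ R? P⊆R Q⊆R disjoint []       = z≤n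
    count-+-≤ R? P⊆R Q⊆R disjoint (x ∷ xs) with P? x | Q? x | R? x | count-+-≤ R? P⊆R Q⊆R disjoint xs
    ... | yes p | yes q | _     | _  = ⊥-elim (disjoint p q)
    ... | yes p | no  _ | no ¬r | _  = ⊥-elim (¬r (P⊆R p))
    ... | no  _ | yes q | no ¬r | _  = ⊥-elim (¬r (Q⊆R q))
    ... | yes _ | no  _ | yes _ | ih = s≤s ih
    ... | no  _ | yes _ | yes _ | ih = ≤-trans (≤-reflexive (+-suc _ _)) (s≤s ih)
    ... | no  _ | no  _ | yes _ | ih = m≤n⇒m≤1+n ih
    ... | no  _ | no  _ | no  _ | ih = ih

count-allSubsets-suc : ∀ {n} {P : Pred (Subset (suc n)) 0ℓ} (P? : Decidable P) →
  count P? (allSubsets (suc n)) ≡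
  count (λ S → P? (outside ∷ S)) (allSubsets n) + count (λ S → P? (inside ∷ S)) (allSubsets n)
count-allSubsets-suc {n} P? = trans (count-++ P? (map (outside ∷_) (allSubsets n)) _)
  (cong₂ _+_ (count-map P? (outside ∷_) (allSubsets n)) (count-map P? (inside ∷_) (allSubsets n)))

meets : ∀ {n} → Subset n → Subset n → Bool
meets []      []      = false
meets (x ∷ p) (y ∷ q) = (x ∧ y) ∨ meets p q

meets⇒Nonempty : ∀ {n} (p q : Subset n) → T (meets p q) → Nonempty (p ∩ q)
meets⇒Nonempty []            []            ()
meets⇒Nonempty (inside  ∷ p) (inside  ∷ q) _ = zero , here
meets⇒Nonempty (inside  ∷ p) (outside ∷ q) m = let i , i∈p∩q = meets⇒Nonempty p q m in suc i , there i∈p∩q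
meets⇒Nonempty (outside ∷ p) (_       ∷ q) m = let i , i∈p∩q = meets⇒Nonempty p q m in suc i , there i∈p∩q

Nonempty⇒meets : ∀ {n} (p q : Subset n) → Nonempty (p ∩ q) → T (meets p q)
Nonempty⇒meets (inside  ∷ p) (inside  ∷ q) _                     = _
Nonempty⇒meets (inside  ∷ p) (outside ∷ q) (suc i , there i∈p∩q) = Nonempty⇒meets p q (i , i∈p∩q)
Nonempty⇒meets (outside ∷ p) (_       ∷ q) (suc i , there i∈p∩q) = Nonempty⇒meets p q (i , i∈p∩q)

-- Unlike nonempty?, meets? computes its verdict by recursion on the vectors, so the counts over
-- allSubsets (suc n) below unfold definitionally into counts over allSubsets n.
meets? : ∀ {n} (p q : Subset n) → Dec (Nonempty (p ∩ q))
meets? p q = map′ (meets⇒Nonempty p q) (Nonempty⇒meets p q) (T? (meets p q))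

Avoiding : ∀ {n} → ℕ → Subset n → Pred (Subset n) 0ℓ
Avoiding r W S = ∣ S ∣ ≡ r × ¬ Nonempty (S ∩ W)

avoiding? : ∀ {n} r (W : Subset n) → Decidable (Avoiding r W)
avoiding? r W S = (∣ S ∣ ≟ r) ×-dec ¬? (meets? S W)

count-avoiding : ∀ {n} r (W : Subset n) → count (avoiding? r W) (allSubsets n) ≡ ∣ ∁ W ∣ C r
count-avoiding {zero}  zero    [] = refl
count-avoiding {zero}  (suc r) [] = refl
count-avoiding {suc n} r (w ∷ W) = begin
  count (avoiding? r (w ∷ W)) (allSubsets (suc n))
    ≡⟨ count-allSubsets-suc (avoiding? r (w ∷ W)) ⟩
  count (λ S → avoiding? r (w ∷ W) (outside ∷ S)) A + containingFirst w r
    ≡⟨ cong (_+ containingFirst w r) (count-does _ (avoiding? r W) (λ _ → refl) A) ⟩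
  count (avoiding? r W) A + containingFirst w r
    ≡⟨ cong (_+ containingFirst w r) (count-avoiding r W) ⟩
  ∣ ∁ W ∣ C r + containingFirst w r
    ≡⟨ add-containingFirst w r ⟩
  ∣ ∁ (w ∷ W) ∣ C r ∎
  where
  open ≡-Reasoning
  A = allSubsets n
  containingFirst : Bool → ℕ → ℕ
  containingFirst w r = count (λ S → avoiding? r (w ∷ W) (inside ∷ S)) A
  add-containingFirst : ∀ w r → ∣ ∁ W ∣ C r + containingFirst w r ≡ ∣ ∁ (w ∷ W) ∣ C r
  add-containingFirst inside r = begin
    ∣ ∁ W ∣ C r + containingFirst inside r
      ≡⟨ cong (∣ ∁ W ∣ C r +_) (count-none _ (λ _ (_ , avoids) → avoids (zero , here)) A) ⟩
    ∣ ∁ W ∣ C r + 0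
      ≡⟨ +-identityʳ _ ⟩
    ∣ ∁ W ∣ C r ∎
  add-containingFirst outside zero = cong suc (count-none _ (λ { _ (() , _) }) A)
  add-containingFirst outside (suc r) = begin
    ∣ ∁ W ∣ C suc r + containingFirst outside (suc r)
      ≡⟨ cong (∣ ∁ W ∣ C suc r +_) (count-does _ (avoiding? r W) (λ _ → refl) A) ⟩
    ∣ ∁ W ∣ C suc r + count (avoiding? r W) A
      ≡⟨ cong (∣ ∁ W ∣ C suc r +_) (count-avoiding r W) ⟩
    ∣ ∁ W ∣ C suc r + ∣ ∁ W ∣ C r
      ≡⟨ +-comm (∣ ∁ W ∣ C suc r) _ ⟩
    ∣ ∁ W ∣ C r + ∣ ∁ W ∣ C suc r
      ≡⟨ pascal ∣ ∁ W ∣ r ⟨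
    suc ∣ ∁ W ∣ C suc r ∎

∣p∣≡∣p∩∁q∣+∣p∩q∣ : ∀ {n} (p q : Subset n) → ∣ p ∣ ≡ ∣ p ∩ ∁ q ∣ + ∣ p ∩ q ∣
∣p∣≡∣p∩∁q∣+∣p∩q∣ []            []            = refl
∣p∣≡∣p∩∁q∣+∣p∩q∣ (inside  ∷ p) (inside  ∷ q) = trans (cong suc (∣p∣≡∣p∩∁q∣+∣p∩q∣ p q)) (sym (+-suc _ _))
∣p∣≡∣p∩∁q∣+∣p∩q∣ (inside  ∷ p) (outside ∷ q) = cong suc (∣p∣≡∣p∩∁q∣+∣p∩q∣ p q)
∣p∣≡∣p∩∁q∣+∣p∩q∣ (outside ∷ p) (_       ∷ q) = ∣p∣≡∣p∩∁q∣+∣p∩q∣ p q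

∣∁q∣≡∣p∩∁q∣+∣∁[q∪p]∣ : ∀ {n} (p q : Subset n) → ∣ ∁ q ∣ ≡ ∣ p ∩ ∁ q ∣ + ∣ ∁ (q ∪ p) ∣
∣∁q∣≡∣p∩∁q∣+∣∁[q∪p]∣ []            []            = refl
∣∁q∣≡∣p∩∁q∣+∣∁[q∪p]∣ (inside  ∷ p) (inside  ∷ q) = ∣∁q∣≡∣p∩∁q∣+∣∁[q∪p]∣ p q
∣∁q∣≡∣p∩∁q∣+∣∁[q∪p]∣ (outside ∷ p) (inside  ∷ q) = ∣∁q∣≡∣p∩∁q∣+∣∁[q∪p]∣ p q
∣∁q∣≡∣p∩∁q∣+∣∁[q∪p]∣ (inside  ∷ p) (outside ∷ q) = cong suc (∣∁q∣≡∣p∩∁q∣+∣∁[q∪p]∣ p q)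
∣∁q∣≡∣p∩∁q∣+∣∁[q∪p]∣ (outside ∷ p) (outside ∷ q) = trans (cong suc (∣∁q∣≡∣p∩∁q∣+∣∁[q∪p]∣ p q)) (sym (+-suc _ _))

Nonempty-∩-monoʳ : ∀ {n} {p q q′ : Subset n} → q ⊆ q′ → Nonempty (p ∩ q) → Nonempty (p ∩ q′)
Nonempty-∩-monoʳ {p = p} {q} q⊆q′ (i , i∈p∩q) =
  let i∈p , i∈q = x∈p∩q⁻ p q i∈p∩q in i , x∈p∩q⁺ (i∈p , q⊆q′ i∈q)

avoids-∪ : ∀ {n} {p q q′ : Subset n} → ¬ Nonempty (p ∩ q) → ¬ Nonempty (p ∩ q′) → ¬ Nonempty (p ∩ (q ∪ q′))
avoids-∪ {p = p} {q} {q′} avoids-q avoids-q′ (i , i∈p∩[q∪q′]) with x∈p∩q⁻ p (q ∪ q′) i∈p∩[q∪q′]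
... | i∈p , i∈q∪q′ with x∈p∪q⁻ q q′ i∈q∪q′
...   | inj₁ i∈q  = avoids-q  (i , x∈p∩q⁺ (i∈p , i∈q))
...   | inj₂ i∈q′ = avoids-q′ (i , x∈p∩q⁺ (i∈p , i∈q′))

count-sized : ∀ {n} r → count (λ S → ∣ S ∣ ≟ r) (allSubsets n) ≡ n C r
count-sized {n} r = begin
  count (λ S → ∣ S ∣ ≟ r) (allSubsets n)
    ≡⟨ count-cong _ (avoiding? r ∅) ((λ sized → sized , avoids-∅) , proj₁) (allSubsets n) ⟩
  count (avoiding? r ∅) (allSubsets n)
    ≡⟨ count-avoiding r ∅ ⟩
  ∣ ∁ ∅ ∣ C r
    ≡⟨ cong (_C r) (trans (∣∁p∣≡n∸∣p∣ ∅) (cong (n ∸_) (∣⊥∣≡0 n))) ⟩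
  n C r ∎
  where
  open ≡-Reasoning
  ∅ : Subset n
  ∅ = ⊥
  avoids-∅ : ∀ {S} → ¬ Nonempty (S ∩ ∅)
  avoids-∅ {S} (i , i∈S∩∅) = ∉⊥ (proj₂ (x∈p∩q⁻ S ∅ i∈S∩∅))

module _ {n : ℕ} (r : ℕ) where

  avoidingMeeting : Subset n → Subset n → ℕ
  avoidingMeeting G Z = count (λ S → avoiding? r G S ×-dec meets? S Z) (allSubsets n)

  ∣∁G∣Cr≡avoidingMeeting+∣∁[G∪Z]∣Cr : ∀ G Z → ∣ ∁ G ∣ C r ≡ avoidingMeeting G Z + ∣ ∁ (G ∪ Z) ∣ C r
  ∣∁G∣Cr≡avoidingMeeting+∣∁[G∪Z]∣Cr G Z = begin
    ∣ ∁ G ∣ C r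
      ≡⟨ count-avoiding r G ⟨
    count (avoiding? r G) (allSubsets n)
      ≡⟨ count-split (avoiding? r G) (λ S → meets? S Z) (allSubsets n) ⟩
    avoidingMeeting G Z + count (λ S → avoiding? r G S ×-dec ¬? (meets? S Z)) (allSubsets n)
      ≡⟨ cong (avoidingMeeting G Z +_)
              (count-cong _ (avoiding? r (G ∪ Z)) (avoids-both , avoids-each) (allSubsets n)) ⟩
    avoidingMeeting G Z + count (avoiding? r (G ∪ Z)) (allSubsets n)
      ≡⟨ cong (avoidingMeeting G Z +_) (count-avoiding r (G ∪ Z)) ⟩
    avoidingMeeting G Z + ∣ ∁ (G ∪ Z) ∣ C r ∎
    where
    open ≡-Reasoning
    avoids-both : ∀ {S} → Avoiding r G S × ¬ Nonempty (S ∩ Z) → Avoiding r (G ∪ Z) S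
    avoids-both ((sized , avoids-G) , avoids-Z) = sized , avoids-∪ avoids-G avoids-Z
    avoids-each : ∀ {S} → Avoiding r (G ∪ Z) S → Avoiding r G S × ¬ Nonempty (S ∩ Z)
    avoids-each (sized , avoids-G∪Z) =
      (sized , avoids-G∪Z ∘ Nonempty-∩-monoʳ (p⊆p∪q Z)) , avoids-G∪Z ∘ Nonempty-∩-monoʳ (q⊆p∪q G Z)

  ∣Z∣Cr≤avoidingMeeting+∣Z∩G∣Cr : ∀ G Z → ∣ Z ∣ ≤ ∣ ∁ G ∣ → ∣ Z ∣ C r ≤ avoidingMeeting G Z + ∣ Z ∩ G ∣ C r
  ∣Z∣Cr≤avoidingMeeting+∣Z∩G∣Cr G Z ∣Z∣≤∣∁G∣ = +-cancelʳ-≤ (m C r) _ _ (begin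
    ∣ Z ∣ C r + m C r     ≡⟨ cong (λ j → j C r + m C r) ∣Z∣≡e+a ⟩
    (e + a) C r + m C r   ≤⟨ C-convex r e a≤m ⟩
    (e + m) C r + a C r   ≡⟨ cong (λ j → j C r + a C r) ∣∁G∣≡e+m ⟨
    ∣ ∁ G ∣ C r + a C r   ≡⟨ cong (_+ a C r) (∣∁G∣Cr≡avoidingMeeting+∣∁[G∪Z]∣Cr G Z) ⟩
    X + m C r + a C r     ≡⟨ +-assoc X (m C r) (a C r) ⟩
    X + (m C r + a C r)   ≡⟨ cong (X +_) (+-comm (m C r) (a C r)) ⟩
    X + (a C r + m C r)   ≡⟨ +-assoc X (a C r) (m C r) ⟨
    X + a C r + m C r     ∎)
    where
    open ≤-Reasoning
    a = ∣ Z ∩ G ∣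
    e = ∣ Z ∩ ∁ G ∣
    m = ∣ ∁ (G ∪ Z) ∣
    X = avoidingMeeting G Z
    ∣Z∣≡e+a : ∣ Z ∣ ≡ e + a
    ∣Z∣≡e+a = ∣p∣≡∣p∩∁q∣+∣p∩q∣ Z G
    ∣∁G∣≡e+m : ∣ ∁ G ∣ ≡ e + m
    ∣∁G∣≡e+m = ∣∁q∣≡∣p∩∁q∣+∣∁[q∪p]∣ Z G
    a≤m : a ≤ m
    a≤m = +-cancelˡ-≤ e a m (subst₂ _≤_ ∣Z∣≡e+a ∣∁G∣≡e+m ∣Z∣≤∣∁G∣)

transversal? : ∀ {n} (𝒢 : List (Subset n)) → Decidable (Transversal 𝒢)
transversal? 𝒢 S = all? (λ G → nonempty? (S ∩ G)) 𝒢

module _ {n : ℕ} (𝒢 : List (Subset n)) (r : ℕ) where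

  NonTransversal : Pred (Subset n) 0ℓ
  NonTransversal S = ∣ S ∣ ≡ r × ¬ Transversal 𝒢 S

  nonTransversal? : Decidable NonTransversal
  nonTransversal? S = (∣ S ∣ ≟ r) ×-dec ¬? (transversal? 𝒢 S)

  nonTransversalsMeeting : Subset n → ℕ
  nonTransversalsMeeting Z = count (λ S → nonTransversal? S ×-dec meets? S Z) (allSubsets n)

  avoiding-member⇒NonTransversal : ∀ {G S} → G ∈ₗ 𝒢 → Avoiding r G S → NonTransversal S
  avoiding-member⇒NonTransversal G∈𝒢 (sized , avoids-G) =
    sized , λ transversal → avoids-G (lookup transversal G∈𝒢)

  avoidingMeeting+nonTransversalsMeeting-∩≤ : ∀ {G} → G ∈ₗ 𝒢 → ∀ Z →
    avoidingMeeting r G Z + nonTransversalsMeeting (Z ∩ G) ≤ nonTransversalsMeeting Z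
  avoidingMeeting+nonTransversalsMeeting-∩≤ {G} G∈𝒢 Z =
    count-+-≤ _ _ _ (map₁ (avoiding-member⇒NonTransversal G∈𝒢)) (map₂ (Nonempty-∩-monoʳ (p∩q⊆p Z G)))
      (λ ((_ , avoids-G) , _) (_ , meets-Z∩G) → avoids-G (Nonempty-∩-monoʳ (p∩q⊆q Z G) meets-Z∩G))
      (allSubsets n)

module _ {n : ℕ} {𝒢 : List (Subset n)} (nonTrivial : NonTrivial 𝒢)
         {k : ℕ} (coUniform : All (λ G → ∣ ∁ G ∣ ≡ k) 𝒢) {r : ℕ} (0<r : 0 < r) where

  member-missing : ∀ i → ∃[ G ] G ∈ₗ 𝒢 × i ∉ G
  member-missing i = find (¬All⇒Any¬ (i ∈?_) 𝒢 (nonTrivial i))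

  ∣Z∣Cr≤nonTransversalsMeeting : ∀ Z → ∣ Z ∣ ≤ k → ∣ Z ∣ C r ≤ nonTransversalsMeeting 𝒢 r Z
  ∣Z∣Cr≤nonTransversalsMeeting Z = go Z (<-wellFounded ∣ Z ∣)
    where
    go : ∀ Z → Acc _<_ ∣ Z ∣ → ∣ Z ∣ ≤ k → ∣ Z ∣ C r ≤ nonTransversalsMeeting 𝒢 r Z
    go Z _ _ with nonempty? Z
    go Z _ _ | no Z-empty = ≤-trans (≤-reflexive ∣Z∣Cr≡0) z≤n
      where
      ∣Z∣Cr≡0 : ∣ Z ∣ C r ≡ 0
      ∣Z∣Cr≡0 = begin
        ∣ Z ∣ C r         ≡⟨ cong (λ Z → ∣ Z ∣ C r) (Empty-unique Z-empty) ⟩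
        ∣ ⊥ {n = n} ∣ C r ≡⟨ cong (_C r) (∣⊥∣≡0 n) ⟩
        0 C r             ≡⟨ k>n⇒nCk≡0 0<r ⟩
        0                 ∎
        where open ≡-Reasoning
    go Z (acc smaller) ∣Z∣≤k | yes (i , i∈Z) with member-missing i
    ... | G , G∈𝒢 , i∉G = begin
      ∣ Z ∣ C r
        ≤⟨ ∣Z∣Cr≤avoidingMeeting+∣Z∩G∣Cr r G Z (subst (∣ Z ∣ ≤_) (sym (lookup coUniform G∈𝒢)) ∣Z∣≤k) ⟩
      avoidingMeeting r G Z + ∣ Z ∩ G ∣ C r
        ≤⟨ +-monoʳ-≤ _ (go (Z ∩ G) (smaller ∣Z∩G∣<∣Z∣) (≤-trans (∣p∩q∣≤∣p∣ Z G) ∣Z∣≤k)) ⟩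
      avoidingMeeting r G Z + nonTransversalsMeeting 𝒢 r (Z ∩ G)
        ≤⟨ avoidingMeeting+nonTransversalsMeeting-∩≤ 𝒢 r G∈𝒢 Z ⟩
      nonTransversalsMeeting 𝒢 r Z ∎
      where
      open ≤-Reasoning
      ∣Z∩G∣<∣Z∣ : ∣ Z ∩ G ∣ < ∣ Z ∣
      ∣Z∩G∣<∣Z∣ = p⊂q⇒∣p∣<∣q∣ (p∩q⊆p Z G , i , i∈Z , i∉G ∘ proj₂ ∘ x∈p∩q⁻ Z G)

  t+kCr+∣G∣Cr≤nCr : ∀ {G} → G ∈ₗ 𝒢 → ∣ G ∣ ≤ k → t 𝒢 r + (k C r + ∣ G ∣ C r) ≤ n C r
  t+kCr+∣G∣Cr≤nCr {G} G∈𝒢 ∣G∣≤k = begin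
    t 𝒢 r + (k C r + ∣ G ∣ C r)
      ≤⟨ +-monoʳ-≤ (t 𝒢 r) (+-mono-≤ (≤-reflexive kCr≡count) (∣Z∣Cr≤nonTransversalsMeeting G ∣G∣≤k)) ⟩
    t 𝒢 r + (count (avoiding? r G) (allSubsets n) + nonTransversalsMeeting 𝒢 r G)
      ≤⟨ +-monoʳ-≤ (t 𝒢 r) (count-+-≤ _ _ (nonTransversal? 𝒢 r)
           (avoiding-member⇒NonTransversal 𝒢 r G∈𝒢) proj₁
           (λ (_ , avoids-G) (_ , meets-G) → avoids-G meets-G) (allSubsets n)) ⟩
    t 𝒢 r + count (nonTransversal? 𝒢 r) (allSubsets n)
      ≡⟨ count-split (λ S → ∣ S ∣ ≟ r) (transversal? 𝒢) (allSubsets n) ⟨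
    count (λ S → ∣ S ∣ ≟ r) (allSubsets n)
      ≡⟨ count-sized r ⟩
    n C r ∎
    where
    open ≤-Reasoning
    kCr≡count : k C r ≡ count (avoiding? r G) (allSubsets n)
    kCr≡count = trans (cong (_C r) (sym (lookup coUniform G∈𝒢))) (sym (count-avoiding r G))

∣∁p∣≡ℓ : ∀ {ℓ} (p : Subset (2 * ℓ)) → ∣ p ∣ ≡ ℓ → ∣ ∁ p ∣ ≡ ℓ
∣∁p∣≡ℓ {ℓ} p ∣p∣≡ℓ = begin
  ∣ ∁ p ∣         ≡⟨ ∣∁p∣≡n∸∣p∣ p ⟩
  2 * ℓ ∸ ∣ p ∣   ≡⟨ cong (2 * ℓ ∸_) ∣p∣≡ℓ ⟩
  ℓ + (ℓ + 0) ∸ ℓ ≡⟨ m+n∸m≡n ℓ (ℓ + 0) ⟩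
  ℓ + 0           ≡⟨ +-identityʳ ℓ ⟩
  ℓ ∎
  where open ≡-Reasoning

lemma4p4 : (ℓ : ℕ) → 2 ≤ ℓ → (𝒢 : List (Subset (2 * ℓ))) → Uniform ℓ 𝒢 → NonTrivial 𝒢 → (r : ℕ) → 2 ≤ r → r < ℓ → t 𝒢 r + 2 * (ℓ C r) ≤ (2 * ℓ) C r
lemma4p4 ℓ@(suc _) _ 𝒢 uniform nonTrivial r 2≤r _ = begin
  t 𝒢 r + 2 * (ℓ C r)         ≡⟨ cong (λ c → t 𝒢 r + (ℓ C r + c)) (+-identityʳ (ℓ C r)) ⟩
  t 𝒢 r + (ℓ C r + ℓ C r)     ≡⟨ cong (λ j → t 𝒢 r + (ℓ C r + j C r)) ∣G∣≡ℓ ⟨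
  t 𝒢 r + (ℓ C r + ∣ G ∣ C r) ≤⟨ t+kCr+∣G∣Cr≤nCr nonTrivial coUniform 0<r G∈𝒢 (≤-reflexive ∣G∣≡ℓ) ⟩
  (2 * ℓ) C r                 ∎
  where
  open ≤-Reasoning
  coUniform : All (λ G → ∣ ∁ G ∣ ≡ ℓ) 𝒢
  coUniform = All.map (λ {G} → ∣∁p∣≡ℓ G) uniform
  0<r : 0 < r
  0<r = ≤-trans (s≤s z≤n) 2≤r
  someMember : ∃[ G ] G ∈ₗ 𝒢 × zero ∉ G
  someMember = member-missing nonTrivial coUniform 0<r zero
  G : Subset (2 * ℓ)
  G = proj₁ someMember
  G∈𝒢 : G ∈ₗ 𝒢
  G∈𝒢 = proj₁ (proj₂ someMember)
  ∣G∣≡ℓ : ∣ G ∣ ≡ ℓ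
  ∣G∣≡ℓ = lookup uniform G∈𝒢
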